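{- Let $G$ be a $3$-lid-colorable connected bipartite graph on at least three vertices, with bipartition $\{U,V\}$, and let $c$ be a $3$-lid-coloring of $G$ with colors $1,2,3$. Then $G$ has a vertex $u$ with $c(N[u])=\{1,2,3\}$, and if $u\in U$, then $c(U)=\{c(u)\}$ and $c(V)=\{1,2,3\}\setminus\{c(u)\}$.
   Context: For a vertex $u$, $N[u]$ is its closed neighborhood; for a coloring $c$ and vertex set $S$, $c(S)$ is the set of colors on $S$. A lid-coloring is a proper vertex-coloring $c$ such that for every edge $uv$ with $N[u]\neq N[v]$, $c(N[u])\neq c(N[v])$. A $3$-lid-coloring is a lid-coloring using at most $3$ colors; a graph is $3$-lid-colorable if it has one. -}

module Defs where

open import Data.Nat using (ℕ)
open import Data.Fin using (Fin)
open import Data.Product using (Σ; ∃; _×_; _,_)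
open import Data.Sum using (_⊎_)
open import Data.Bool using (Bool)
open import Relation.Nullary using (¬_; Dec)
open import Relation.Binary.PropositionalEquality using (_≡_; _≢_)
open import Function.Bundles using (_⇔_)

record Graph (n : ℕ) : Set₁ where
  field
    Adj     : Fin n → Fin n → Set
    adj?    : ∀ u v → Dec (Adj u v)
    sym     : ∀ {u v} → Adj u v → Adj v u
    irrefl  : ∀ {u} → ¬ Adj u u

module _ {n : ℕ} (G : Graph n) where
  open Graph G

  InN[_] : Fin n → Fin n → Set
  InN[ u ] w = (w ≡ u) ⊎ Adj u w

  SameClosedNbhd : Fin n → Fin n → Set
  SameClosedNbhd u v = ∀ w → (InN[ u ] w ⇔ InN[ v ] w)

  data Reach : Fin n → Fin n → Set where
    here : ∀ {u} → Reach u u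
    step : ∀ {u v w} → Adj u v → Reach v w → Reach u w

  Connected : Set
  Connected = ∀ u v → Reach u v

  -- a bipartition {U,V}: U = side⁻¹(false), V = side⁻¹(true)
  IsBipartition : (Fin n → Bool) → Set
  IsBipartition side = ∀ {u v} → Adj u v → side u ≢ side v

  module _ {k : ℕ} (c : Fin n → Fin k) where
    InColN[_] : Fin n → Fin k → Set
    InColN[ u ] a = ∃ λ w → InN[ u ] w × c w ≡ a

    SameColN : Fin n → Fin n → Set
    SameColN u v = ∀ a → (InColN[ u ] a ⇔ InColN[ v ] a)

    ProperColoring : Set
    ProperColoring = ∀ {u v} → Adj u v → c u ≢ c v

    IsLidColoring : Set
    IsLidColoring = ProperColoring ×
      (∀ {u v} → Adj u v → ¬ SameClosedNbhd u v → ¬ SameColN u v)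

Is3LidColoring : ∀ {n} (G : Graph n) → (Fin n → Fin 3) → Set
Is3LidColoring G c = IsLidColoring G c

Is3LidColorable : ∀ {n} (G : Graph n) → Set
Is3LidColorable G = ∃ λ c → Is3LidColoring G c

module Submission where

-- Let c be a 3-lid-colouring of a connected bipartite graph G on
-- n ≥ 3 vertices, and call a vertex x *full* when c(N[x]) = {1,2,3}.
--   * Connectedness and n ≥ 3 give every edge uv a vertex outside {u,v}
--     adjacent to u or v; bipartiteness (no triangles) then gives N[u] ≠ N[v].
--     Hence the lid condition applies to every edge: c(N[u]) ≠ c(N[v]).
--   * So the two ends of an edge are never both full.  If x is not full and
--     xy is an edge, then c(N[x]) = {c x, c y}; so the ends of an edge are not
--     both non-full either.  Exactly one end of every edge is full.
--   * Fixing a full vertex u and walking through G from u, full vertices (on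
--     the side of u, all of colour c u) and non-full vertices (on the other
--     side, adjacent to a vertex of colour c u) alternate.  A non-full vertex
--     sees only two colours, so all its neighbours share one colour.

open import Defs
open import Level using (0ℓ)
open import Data.Nat using (ℕ; _+_; _≤_; suc; s≤s)
open import Data.Fin using (Fin; zero; suc; _≟_; punchIn; punchOut)
open import Data.Fin.Properties
  using (any?; all?; ¬∀⟶∃¬; punchOut-injective; punchIn-injective; punchInᵢ≢i; punchIn-punchOut)
open import Data.Bool using (Bool; not)
open import Data.Bool.Properties using (¬-not; not-involutive)
open import Data.Product using (∃; ∃₂; _×_; _,_; proj₁; proj₂)
open import Data.Sum using (_⊎_; inj₁; inj₂)
open import Data.Empty using (⊥; ⊥-elim)
open import Function using (_∘_)
open import Relation.Nullary using (¬_; Dec; yes; no)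
open import Relation.Nullary.Decidable using (_×-dec_; _⊎-dec_)
open import Relation.Unary using (Pred; Decidable)
open import Relation.Binary.PropositionalEquality
  using (_≡_; _≢_; refl; sym; trans; cong)
open import Function.Bundles using (_⇔_; mk⇔; Equivalence)

fin1-unique : (i j : Fin 1) → i ≡ j
fin1-unique zero zero = refl

fin2-cover : (x y b : Fin 2) → x ≢ y → b ≡ x ⊎ b ≡ y
fin2-cover x y b x≢y with b ≟ x
... | yes b≡x = inj₁ b≡x
... | no b≢x = inj₂ (punchOut-injective (b≢x ∘ sym) x≢y (fin1-unique _ _))

-- Every element of Fin 3 is one of any three pairwise distinct elements:
-- removing x reduces the claim to Fin 2.
fin3-cover : (x y z b : Fin 3) → x ≢ y → x ≢ z → y ≢ z → b ≡ x ⊎ b ≡ y ⊎ b ≡ z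
fin3-cover x y z b x≢y x≢z y≢z with b ≟ x
... | yes b≡x = inj₁ b≡x
... | no b≢x
  with fin2-cover (punchOut x≢y) (punchOut x≢z) (punchOut (b≢x ∘ sym))
                  (y≢z ∘ punchOut-injective x≢y x≢z)
...   | inj₁ b~y = inj₂ (inj₁ (punchOut-injective (b≢x ∘ sym) x≢y b~y))
...   | inj₂ b~z = inj₂ (inj₂ (punchOut-injective (b≢x ∘ sym) x≢z b~z))

third-vertex : ∀ {m} (u v : Fin (3 + m)) → ∃ λ w → w ≢ u × w ≢ v
third-vertex u v with v ≟ u
... | yes refl = punchIn u zero , punchInᵢ≢i u zero , punchInᵢ≢i u zero
... | no v≢u = punchIn u w′ , punchInᵢ≢i u w′ , w≢v
  where
  v′ : Fin (2 + _)
  v′ = punchOut (v≢u ∘ sym)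
  w′ : Fin (2 + _)
  w′ = punchIn v′ zero
  w≢v : punchIn u w′ ≢ v
  w≢v w≡v = punchInᵢ≢i v′ zero
    (punchIn-injective u w′ v′ (trans w≡v (sym (punchIn-punchOut (v≢u ∘ sym)))))

both-differ : ∀ {a b c : Bool} → a ≢ b → c ≢ b → a ≡ c
both-differ a≢b c≢b = trans (¬-not a≢b) (sym (¬-not c≢b))

module Walks {n : ℕ} (G : Graph n) where
  open Graph G

  leave : (S : Pred (Fin n) 0ℓ) → Decidable S → ∀ {x w} → Reach G x w → S x → ¬ S w →
          ∃₂ λ z y → S z × Adj z y × ¬ S y
  leave S S? here Sx ¬Sw = ⊥-elim (¬Sw Sx)
  leave S S? {x} (step {v = y} x~y walk) Sx ¬Sw with S? y
  ... | yes Sy = leave S S? walk Sy ¬Sw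
  ... | no ¬Sy = x , y , Sx , x~y , ¬Sy

  first-step : ∀ {x w} → Reach G x w → x ≢ w → ∃ λ y → Adj x y
  first-step here x≢x = ⊥-elim (x≢x refl)
  first-step (step x~y _) _ = _ , x~y

module Bipartite {n : ℕ} (G : Graph n) (side : Fin n → Bool) (bip : IsBipartition G side) where
  open Graph G renaming (sym to adj-sym)
  open Walks G

  opposite : ∀ {u v} → Adj u v → side v ≡ not (side u)
  opposite u~v = ¬-not (bip (adj-sym u~v))

  -- A bipartite graph has no triangle: the sides would have to alternate
  -- around an odd cycle.
  no-triangle : ∀ {u v w} → Adj u v → Adj v w → Adj u w → ⊥
  no-triangle {u} {v} {w} u~v v~w u~w = bip u~w (sym side-w≡side-u)
    where
    side-w≡side-u : side w ≡ side u
    side-w≡side-u = trans (opposite v~w)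
      (trans (cong not (opposite u~v)) (not-involutive (side u)))

  Pair : Fin n → Fin n → Pred (Fin n) 0ℓ
  Pair u v z = z ≡ u ⊎ z ≡ v

  -- Without triangles, an edge uv with N[u] = N[v] has no edge leaving {u,v}:
  -- a further neighbour of u would also be a neighbour of v.
  twin-edge-closed : ∀ {u v z y} → Adj u v → SameClosedNbhd G u v →
                     Pair u v z → Adj z y → Pair u v y
  twin-edge-closed u~v same (inj₁ refl) u~y with Equivalence.to (same _) (inj₂ u~y)
  ... | inj₁ y≡v = inj₂ y≡v
  ... | inj₂ v~y = ⊥-elim (no-triangle u~v v~y u~y)
  twin-edge-closed u~v same (inj₂ refl) v~y with Equivalence.from (same _) (inj₂ v~y)
  ... | inj₁ y≡u = inj₁ y≡u
  ... | inj₂ u~y = ⊥-elim (no-triangle u~v v~y u~y)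

  no-twins : Connected G → ∀ {u v w} → w ≢ u → w ≢ v → Adj u v → ¬ SameClosedNbhd G u v
  no-twins conn {u} {v} {w} w≢u w≢v u~v same
    with leave (Pair u v) (λ z → (z ≟ u) ⊎-dec (z ≟ v)) (conn u w) (inj₁ refl) outside
    where
    outside : ¬ Pair u v w
    outside (inj₁ w≡u) = w≢u w≡u
    outside (inj₂ w≡v) = w≢v w≡v
  ... | z , y , z∈uv , z~y , y∉uv = y∉uv (twin-edge-closed u~v same z∈uv z~y)

module ThreeLid {m : ℕ} (G : Graph (3 + m)) (conn : Connected G)
  (side : Fin (3 + m) → Bool) (bip : IsBipartition G side)
  (c : Fin (3 + m) → Fin 3) (lid : Is3LidColoring G c) where
  open Graph G renaming (sym to adj-sym)
  open Walks G
  open Bipartite G side bip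

  private
    Vertex : Set
    Vertex = Fin (3 + m)
    proper : ∀ {x y} → Adj x y → c x ≢ c y
    proper = proj₁ lid

  InC : Vertex → Fin 3 → Set
  InC x a = InColN[_] G c x a

  Full : Vertex → Set
  Full x = ∀ a → InC x a

  inC? : ∀ x a → Dec (InC x a)
  inC? x a = any? λ w → ((w ≟ x) ⊎-dec adj? x w) ×-dec (c w ≟ a)

  full? : ∀ x → Dec (Full x)
  full? x = all? (inC? x)

  own-colour : ∀ x → InC x (c x)
  own-colour x = x , inj₁ refl , refl

  nbr-colour : ∀ {x y} → Adj x y → InC x (c y)
  nbr-colour x~y = _ , inj₂ x~y , refl

  distinct-colour-sets : ∀ {x y} → Adj x y → ¬ SameColN G c x y
  distinct-colour-sets {x} {y} x~y with third-vertex x y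
  ... | w , w≢x , w≢y = proj₂ lid x~y (no-twins conn w≢x w≢y x~y)

  -- Two adjacent full vertices would have equal colour sets.
  not-both-full : ∀ {x y} → Adj x y → Full x → Full y → ⊥
  not-both-full x~y full-x full-y =
    distinct-colour-sets x~y λ a → mk⇔ (λ _ → full-y a) (λ _ → full-x a)

  -- A non-full vertex sees only its own colour and that of any neighbour:
  -- the missing colour differs from both, and Fin 3 has no fourth colour.
  nonfull-colours : ∀ {x y} → Adj x y → ¬ Full x → ∀ {b} → InC x b → b ≡ c x ⊎ b ≡ c y
  nonfull-colours {x} {y} x~y nonfull {b} b∈x with ¬∀⟶∃¬ 3 (InC x) (inC? x) nonfull
  ... | a , a∉x
    with fin3-cover (c x) (c y) a b (proper x~y) (absent (own-colour x)) (absent (nbr-colour x~y))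
    where
    absent : ∀ {d} → InC x d → d ≢ a
    absent d∈x refl = a∉x d∈x
  ... | inj₁ b≡cx = inj₁ b≡cx
  ... | inj₂ (inj₁ b≡cy) = inj₂ b≡cy
  ... | inj₂ (inj₂ refl) = ⊥-elim (a∉x b∈x)

  -- Two adjacent non-full vertices would both see exactly {c x, c y}.
  not-both-nonfull : ∀ {x y} → Adj x y → ¬ Full x → ¬ Full y → ⊥
  not-both-nonfull {x} {y} x~y nonfull-x nonfull-y =
    distinct-colour-sets x~y λ b → mk⇔ (into-y ∘ nonfull-colours x~y nonfull-x)
                                       (into-x ∘ nonfull-colours (adj-sym x~y) nonfull-y)
    where
    into-y : ∀ {b} → b ≡ c x ⊎ b ≡ c y → InC y b
    into-y (inj₁ refl) = nbr-colour (adj-sym x~y)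
    into-y (inj₂ refl) = own-colour y
    into-x : ∀ {b} → b ≡ c y ⊎ b ≡ c x → InC x b
    into-x (inj₁ refl) = nbr-colour x~y
    into-x (inj₂ refl) = own-colour x

  one-end-full : ∀ {x y} → Adj x y → ¬ Full x → Full y
  one-end-full {y = y} x~y nonfull-x with full? y
  ... | yes full-y = full-y
  ... | no nonfull-y = ⊥-elim (not-both-nonfull x~y nonfull-x nonfull-y)

  nonfull-nbrs-agree : ∀ {x y z} → ¬ Full x → Adj x y → Adj x z → c z ≡ c y
  nonfull-nbrs-agree nonfull x~y x~z with nonfull-colours x~y nonfull (nbr-colour x~z)
  ... | inj₁ cz≡cx = ⊥-elim (proper x~z (sym cz≡cx))
  ... | inj₂ cz≡cy = cz≡cy

  -- Some vertex is full: vertex 0, or else any neighbour of it.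
  full-vertex : ∃ Full
  full-vertex with full? zero
  ... | yes full-0 = zero , full-0
  ... | no nonfull-0 with first-step (conn zero (suc zero)) (λ ())
  ...   | y , 0~y = y , one-end-full 0~y nonfull-0

  module AroundFull (u : Vertex) (full-u : Full u) where

    data Phase (x : Vertex) : Set where
      inner : side x ≡ side u → c x ≡ c u → Full x → Phase x
      outer : side x ≢ side u → ¬ Full x → ∃ (λ y → Adj x y × c y ≡ c u) → Phase x

    phase-step : ∀ {x y} → Adj x y → Phase x → Phase y
    phase-step x~y (inner sx cx full-x) =
      outer (λ sy → bip x~y (trans sx (sym sy))) (not-both-full x~y full-x) (_ , adj-sym x~y , cx)
    phase-step x~y (outer sx nonfull-x (z , x~z , cz)) =
      inner (both-differ (bip x~y ∘ sym) (sx ∘ sym))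
            (trans (nonfull-nbrs-agree nonfull-x x~z x~y) cz)
            (one-end-full x~y nonfull-x)

    phase : ∀ w → Phase w
    phase w = walk (conn u w) (inner refl refl full-u)
      where
      walk : ∀ {x y} → Reach G x y → Phase x → Phase y
      walk here p = p
      walk (step x~z rest) p = walk rest (phase-step x~z p)

    same-side-colour : ∀ w → side w ≡ side u → c w ≡ c u
    same-side-colour w sw with phase w
    ... | inner _ cw _ = cw
    ... | outer sw′ _ _ = ⊥-elim (sw′ sw)

    other-side-colours : ∀ a → (∃ λ w → side w ≢ side u × c w ≡ a) ⇔ (a ≢ c u)
    other-side-colours a = mk⇔ only-others all-others
      where
      only-others : (∃ λ w → side w ≢ side u × c w ≡ a) → a ≢ c u
      only-others (w , sw , refl) with phase w
      ... | inner sw′ _ _ = ⊥-elim (sw sw′)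
      ... | outer _ _ (y , w~y , cy) = λ cw≡cu → proper w~y (trans cw≡cu (sym cy))
      all-others : a ≢ c u → ∃ λ w → side w ≢ side u × c w ≡ a
      all-others a≢cu with full-u a
      ... | w , inj₁ refl , cu≡a = ⊥-elim (a≢cu (sym cu≡a))
      ... | w , inj₂ u~w , cw≡a = w , bip (adj-sym u~w) , cw≡a

mainTheorem18 : ∀ {n : ℕ} (G : Graph n) → Is3LidColorable G → Connected G → 3 ≤ n
    → (side : Fin n → Bool) → IsBipartition G side
    → (c : Fin n → Fin 3) → Is3LidColoring G c
    → ∃ λ u → (∀ a → InColN[_] G c u a)
    × (∀ w → side w ≡ side u → c w ≡ c u)
    × (∀ a → ((∃ λ w → side w ≢ side u × c w ≡ a) ⇔ (a ≢ c u)))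
mainTheorem18 {suc (suc (suc m))} G _ conn (s≤s (s≤s (s≤s _))) side bip c lid =
  u , full-u , same-side-colour , other-side-colours
  where
  open ThreeLid G conn side bip c lid
  u : Fin (3 + m)
  u = proj₁ full-vertex
  full-u : Full u
  full-u = proj₂ full-vertex
  open AroundFull u full-u
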